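{- Let $(A,B) \in \mathbb{Z}^2$ be such that $4A^3 + 27B^2 \neq 0$. Let $d \geq 1$ be a squarefree integer and let $(x,y,z) \in \mathbb{Z} \times \mathbb{Z}_{\geq 1}^2$ satisfy $\gcd(x,y,z) = 1$ and \[ d y^2 z = x^3 + A x z^2 + B z^3. \] Then there is a unique way to write $x = d_1 b_1 x_1$, $z = d_1^2 b_1^3$ and $d = d_0 d_1$ with $(d_0, d_1, b_1, x_1) \in \mathbb{Z}_{\geq 1}^3 \times \mathbb{Z}$ satisfying $|\mu(d_0 d_1)| = 1$, $\gcd(x_1, d_1 b_1) = 1$, and \[ d_0 y^2 = x_1^3 + A x_1 d_1^2 b_1^4 + B d_1^3 b_1^6. \]
   Context: $\mu$ denotes the Möbius function; $\mathbb{Z}_{\geq 1}$ denotes the set of positive integers. -}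

module Defs where

open import Data.Nat using (ℕ; _*_)
open import Data.Nat.Divisibility using (_∣_)
open import Relation.Binary.PropositionalEquality using (_≡_)

-- A natural number n is squarefree if the only m with m² ∣ n is m = 1.
-- (In particular 0 is not squarefree.)
Squarefree : ℕ → Set
Squarefree n = ∀ m → m * m ∣ n → m ≡ 1

-- |μ(n)| = 1, with μ the Möbius function: for n ≥ 1 this holds exactly
-- when n is squarefree (μ(n) = (-1)^k for squarefree n, 0 otherwise).
AbsMobiusIsOne : ℕ → Set
AbsMobiusIsOne n = Squarefree n

module Submission where

-- Write F(x, z) = x³ + A x z² + B z³ and g = gcd(|x|, z), so
-- that x = x′ g and z = z′ g with |x′| and z′ coprime.  As F is homogeneous
-- of degree 3, the equation becomes d y² z′ = g² F(x′, z′); since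
-- F(x′, z′) ≡ x′³ (mod z′) is coprime to z′, we get z′ ∣ g², say g² = t z′,
-- and then d y² = t F(x′, z′).  Now gcd(g, y) = 1 forces t ∣ d, and d being
-- squarefree turns t ∣ g² into t ∣ g.  Hence g = b t, z′ = b² t, d = s t and
-- s y² = F(x′, b² t), so (d₀, d₁, b₁, x₁) = (s, t, b, x′) works.
-- Uniqueness: gcd(x₁, d₁ b₁) = 1 forces d₁ b₁ = gcd(|x|, z), and then b₁,
-- d₁, d₀ and x₁ are recovered one after the other by cancellation.

open import Defs
open import Data.Nat using (ℕ; _≥_) renaming (_*_ to _*ℕ_; _^_ to _^ℕ_)
open import Data.Nat.GCD using (gcd)
open import Data.Integer using (ℤ; +_; _+_; _*_; _^_; ∣_∣)
open import Data.Product using (_×_; _,_; ∃!)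
open import Relation.Binary.PropositionalEquality using (_≡_; _≢_)

open import Data.Nat using (zero; suc; NonZero; ≢-nonZero; ≢-nonZero⁻¹; >-nonZero; >-nonZero⁻¹)
open import Data.Nat.Properties
  using (*-identityˡ; *-identityʳ; *-comm; *-cancelˡ-≡; *-cancelʳ-≡;
         m*n≢0; m*n≢0⇒m≢0; m*n≢0⇒n≢0; n>0⇒n≢0)
open import Data.Nat.Divisibility
  using (_∣_; divides; ∣-trans; ∣1⇒≡1; n∣m*n; *-monoʳ-∣; *-cancelʳ-∣; quotient;
         m∣n⇒n≡quotient*m)
open import Data.Nat.GCD
  using (GCD; gcd[m,n]∣m; gcd[m,n]∣n; gcd-greatest; gcd[m,n]≢0; gcd-GCD; GCD-*;
         c*gcd[m,n]≡gcd[cm,cn])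
open import Data.Nat.Coprimality as Coprimality
  using (Coprime; coprime-divisor; coprime⇒gcd≡1; gcd≡1⇒coprime; GCD≡1⇒coprime)
import Data.Integer.Properties as ℤ
import Data.Integer.Divisibility.Signed as ℤ∣
open import Data.Integer.Tactic.RingSolver using (solve-∀)
import Data.Nat.Tactic.RingSolver as ℕ-Ring
open import Data.Product using (Σ; ∃₂; proj₁; proj₂)
open import Data.Sum using (inj₁; inj₂)
open import Relation.Binary.PropositionalEquality
  using (refl; sym; trans; cong; cong₂; subst; subst₂; module ≡-Reasoning)

open ≡-Reasoning

coprime-divisorˡ : ∀ {m n k} → Coprime m n → k ∣ m → Coprime k n
coprime-divisorˡ m⊥n k∣m (i∣k , i∣n) = m⊥n (∣-trans i∣k k∣m , i∣n)

coprime-*ʳ : ∀ {m n o} → Coprime m n → Coprime m o → Coprime m (n *ℕ o)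
coprime-*ʳ m⊥n m⊥o (i∣m , i∣no) =
  m⊥o (i∣m , coprime-divisor (coprime-divisorˡ m⊥n i∣m) i∣no)

coprime-square : ∀ {m n} → Coprime m n → Coprime (m *ℕ m) (n *ℕ n)
coprime-square {m} {n} m⊥n = coprime-*ʳ mm⊥n mm⊥n
  where
  mm⊥n : Coprime (m *ℕ m) n
  mm⊥n = Coprimality.sym (coprime-*ʳ (Coprimality.sym m⊥n) (Coprimality.sym m⊥n))

coprime-∣-power : ∀ {k m} n → Coprime k m → k ∣ m ^ℕ n → k ≡ 1
coprime-∣-power zero    k⊥m k∣1    = ∣1⇒≡1 k∣1
coprime-∣-power (suc n) k⊥m k∣mmⁿ = coprime-∣-power n k⊥m (coprime-divisor k⊥m k∣mmⁿ)

coprime-cofactors : ∀ {m n m′ n′} .{{_ : NonZero (gcd m n)}} →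
                    m ≡ m′ *ℕ gcd m n → n ≡ n′ *ℕ gcd m n → Coprime m′ n′
coprime-cofactors {m} {n} {m′} {n′} m≡ n≡ = GCD≡1⇒coprime (GCD-* gcd-of-multiples)
  where
  gcd-of-multiples : GCD (m′ *ℕ gcd m n) (n′ *ℕ gcd m n) (1 *ℕ gcd m n)
  gcd-of-multiples = subst₂ (λ a b → GCD a b (1 *ℕ gcd m n)) m≡ n≡
                       (subst (GCD m n) (sym (*-identityˡ (gcd m n))) (gcd-GCD m n))

gcd-scaled-coprime : ∀ c {m n} → Coprime m n → gcd (c *ℕ m) (c *ℕ n) ≡ c
gcd-scaled-coprime c {m} {n} m⊥n = begin
  gcd (c *ℕ m) (c *ℕ n) ≡⟨ sym (c*gcd[m,n]≡gcd[cm,cn] c m n) ⟩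
  c *ℕ gcd m n          ≡⟨ cong (c *ℕ_) (coprime⇒gcd≡1 m⊥n) ⟩
  c *ℕ 1                ≡⟨ *-identityʳ c ⟩
  c                     ∎

coprime-gcd : ∀ {a b c} → gcd (gcd a b) c ≡ 1 → Coprime (gcd a c) b
coprime-gcd {a} {b} {c} gcd≡1 (i∣gcd , i∣b) =
  ∣1⇒≡1 (subst (_ ∣_) gcd≡1
    (gcd-greatest (gcd-greatest (∣-trans i∣gcd (gcd[m,n]∣m a c)) i∣b)
                  (∣-trans i∣gcd (gcd[m,n]∣n a c))))

-- A divisor t of a squarefree number that divides g² already divides g:
-- with e = gcd(t, g), t = t′e and g = g′e, the cofactor t′ is coprime to g′
-- and divides g′²e, hence divides e; so t′² ∣ t ∣ d and t′ = 1.
squarefree-∣-square : ∀ {d t g} → Squarefree d → .{{_ : NonZero t}} →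
                      t ∣ d → t ∣ g *ℕ g → t ∣ g
squarefree-∣-square {d} {t} {g} d-sqf t∣d t∣gg = subst (_∣ g) (sym t≡e) (gcd[m,n]∣n t g)
  where
  e = gcd t g
  instance
    e≢0 : NonZero e
    e≢0 = ≢-nonZero (gcd[m,n]≢0 t g (inj₁ (≢-nonZero⁻¹ t)))
  t′ = quotient (gcd[m,n]∣m t g)
  g′ = quotient (gcd[m,n]∣n t g)
  t≡ : t ≡ t′ *ℕ e
  t≡ = m∣n⇒n≡quotient*m (gcd[m,n]∣m t g)
  g≡ : g ≡ g′ *ℕ e
  g≡ = m∣n⇒n≡quotient*m (gcd[m,n]∣n t g)
  t′⊥g′ : Coprime t′ g′
  t′⊥g′ = coprime-cofactors t≡ g≡
  gg≡ : g *ℕ g ≡ g′ *ℕ (g′ *ℕ e) *ℕ e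
  gg≡ = trans (cong (λ h → h *ℕ h) g≡) (regroup g′ e)
    where
    regroup : ∀ a b → a *ℕ b *ℕ (a *ℕ b) ≡ a *ℕ (a *ℕ b) *ℕ b
    regroup = ℕ-Ring.solve-∀
  t′∣e : t′ ∣ e
  t′∣e = coprime-divisor t′⊥g′ (coprime-divisor t′⊥g′
           (*-cancelʳ-∣ e (subst₂ _∣_ t≡ gg≡ t∣gg)))
  t′≡1 : t′ ≡ 1
  t′≡1 = d-sqf t′ (∣-trans (*-monoʳ-∣ t′ t′∣e) (subst (_∣ d) t≡ t∣d))
  t≡e : t ≡ e
  t≡e = trans t≡ (trans (cong (_*ℕ e) t′≡1) (*-identityˡ e))

square-part : ∀ {d y z′ g r} → Squarefree d → .{{_ : NonZero g}} →
              Coprime g y → Coprime z′ r →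
              d *ℕ (y *ℕ y) *ℕ z′ ≡ g *ℕ g *ℕ r →
              ∃₂ λ b t → g ≡ b *ℕ t × z′ ≡ b *ℕ b *ℕ t × t ∣ d
square-part {d} {y} {z′} {g} {r} d-sqf g⊥y z′⊥r eq
  with coprime-divisor z′⊥r (divides (d *ℕ (y *ℕ y)) (trans (*-comm r (g *ℕ g)) (sym eq)))
... | divides t gg≡tz′ = b , t , g≡bt , z′≡bbt , t∣d
  where
  instance
    tz′≢0 : NonZero (t *ℕ z′)
    tz′≢0 = subst NonZero gg≡tz′ (m*n≢0 g g)
    t≢0 : NonZero t
    t≢0 = m*n≢0⇒m≢0 t
    z′≢0 : NonZero z′
    z′≢0 = m*n≢0⇒n≢0 t
  dyy≡tr : d *ℕ (y *ℕ y) ≡ t *ℕ r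
  dyy≡tr = *-cancelʳ-≡ _ _ z′ (trans eq (trans (cong (_*ℕ r) gg≡tz′) (swap t z′ r)))
    where
    swap : ∀ a b c → a *ℕ b *ℕ c ≡ a *ℕ c *ℕ b
    swap = ℕ-Ring.solve-∀
  t∣gg : t ∣ g *ℕ g
  t∣gg = divides z′ (trans gg≡tz′ (*-comm t z′))
  -- t ⊥ y² because t ∣ g² and g² ⊥ y²
  t∣d : t ∣ d
  t∣d = coprime-divisor (coprime-divisorˡ (coprime-square g⊥y) t∣gg)
          (divides r (trans (*-comm (y *ℕ y) d) (trans dyy≡tr (*-comm t r))))
  b = quotient (squarefree-∣-square d-sqf t∣d t∣gg)
  g≡bt : g ≡ b *ℕ t
  g≡bt = m∣n⇒n≡quotient*m (squarefree-∣-square d-sqf t∣d t∣gg)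
  z′≡bbt : z′ ≡ b *ℕ b *ℕ t
  z′≡bbt = *-cancelˡ-≡ _ _ t (begin
    t *ℕ z′                  ≡⟨ sym gg≡tz′ ⟩
    g *ℕ g                   ≡⟨ cong (λ h → h *ℕ h) g≡bt ⟩
    b *ℕ t *ℕ (b *ℕ t)       ≡⟨ regroup b t ⟩
    t *ℕ (b *ℕ b *ℕ t)       ∎)
    where
    regroup : ∀ a b → a *ℕ b *ℕ (a *ℕ b) ≡ b *ℕ (a *ℕ a *ℕ b)
    regroup = ℕ-Ring.solve-∀

cubic : ℤ → ℤ → ℤ → ℤ → ℤ
cubic A B x z = x ^ 3 + A * x * z ^ 2 + B * z ^ 3

-- F is homogeneous of degree 3: F(x g, z g) = g³ F(x, z).  (The ring solver
-- is applied to the statement with the powers written out as products.)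
cubic-homogeneous : ∀ A B x z g → cubic A B (x * g) (z * g) ≡ g * (g * g * cubic A B x z)
cubic-homogeneous = expanded
  where
  expanded : ∀ A B x z g →
    x * g * (x * g * (x * g * + 1)) + A * (x * g) * (z * g * (z * g * + 1))
      + B * (z * g * (z * g * (z * g * + 1)))
    ≡ g * (g * g * (x * (x * (x * + 1)) + A * x * (z * (z * + 1)) + B * (z * (z * (z * + 1)))))
  expanded = solve-∀

cubic-mod-z : ∀ A B x z → cubic A B x z ≡ x ^ 3 + z * (A * x * z + B * z * z)
cubic-mod-z = expanded
  where
  expanded : ∀ A B x z →
    x * (x * (x * + 1)) + A * x * (z * (z * + 1)) + B * (z * (z * (z * + 1)))
    ≡ x * (x * (x * + 1)) + z * (A * x * z + B * z * z)
  expanded = solve-∀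

cubic-at-b²t : ∀ A B x b t →
  cubic A B x (+ (b *ℕ b *ℕ t)) ≡ x ^ 3 + A * x * (+ t) ^ 2 * (+ b) ^ 4 + B * (+ t) ^ 3 * (+ b) ^ 6
cubic-at-b²t A B x b t =
  trans (cong (cubic A B x) (trans (ℤ.pos-* (b *ℕ b) t) (cong (_* + t) (ℤ.pos-* b b))))
        (expanded A B x (+ b) (+ t))
  where
  expanded : ∀ A B x b t →
    x * (x * (x * + 1)) + A * x * (b * b * t * (b * b * t * + 1))
      + B * (b * b * t * (b * b * t * (b * b * t * + 1)))
    ≡ x * (x * (x * + 1)) + A * x * (t * (t * + 1)) * (b * (b * (b * (b * + 1))))
      + B * (t * (t * (t * + 1))) * (b * (b * (b * (b * (b * (b * + 1))))))
  expanded = solve-∀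

abs-^ : ∀ x n → ∣ x ^ n ∣ ≡ ∣ x ∣ ^ℕ n
abs-^ x zero    = refl
abs-^ x (suc n) = trans (ℤ.abs-* x (x ^ n)) (cong (∣ x ∣ *ℕ_) (abs-^ x n))

-- If x ⊥ z then z ⊥ F(x, z): a common divisor of z and F(x, z) divides x³
-- while being coprime to x.
cubic-coprime : ∀ A B x z → Coprime ∣ x ∣ z → Coprime z ∣ cubic A B x (+ z) ∣
cubic-coprime A B x z x⊥z {k} (k∣z , k∣F) =
  coprime-∣-power 3 (coprime-divisorˡ (Coprimality.sym x⊥z) k∣z)
    (subst (k ∣_) (abs-^ x 3) (ℤ∣.∣⇒∣ᵤ k∣x³))
  where
  k∣x³ : + k ℤ∣.∣ x ^ 3
  k∣x³ = ℤ∣.∣m+n∣n⇒∣m (subst (+ k ℤ∣.∣_) (cubic-mod-z A B x (+ z)) (ℤ∣.∣ᵤ⇒∣ k∣F))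
                      (ℤ∣.∣m⇒∣m*n {+ k} {+ z} (A * x * + z + B * + z * + z) (ℤ∣.∣ᵤ⇒∣ k∣z))

Decomposition : (A B : ℤ) (d : ℕ) (x : ℤ) (y z : ℕ) → ℕ × ℕ × ℕ × ℤ → Set
Decomposition A B d x y z (d₀ , d₁ , b₁ , x₁) =
  d₀ ≥ 1 × d₁ ≥ 1 × b₁ ≥ 1 ×
  x ≡ (+ d₁) * (+ b₁) * x₁ ×
  z ≡ (d₁ ^ℕ 2) *ℕ (b₁ ^ℕ 3) ×
  d ≡ d₀ *ℕ d₁ ×
  AbsMobiusIsOne (d₀ *ℕ d₁) ×
  gcd ∣ x₁ ∣ (d₁ *ℕ b₁) ≡ 1 ×
  (+ d₀) * (+ y) ^ 2 ≡ x₁ ^ 3 + A * x₁ * (+ d₁) ^ 2 * (+ b₁) ^ 4 + B * (+ d₁) ^ 3 * (+ b₁) ^ 6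

d₁²b₁³≡c·cb₁ : ∀ d₁ b₁ → d₁ ^ℕ 2 *ℕ b₁ ^ℕ 3 ≡ d₁ *ℕ b₁ *ℕ (d₁ *ℕ b₁ *ℕ b₁)
d₁²b₁³≡c·cb₁ = expanded
  where
  expanded : ∀ d₁ b₁ →
    d₁ *ℕ (d₁ *ℕ 1) *ℕ (b₁ *ℕ (b₁ *ℕ (b₁ *ℕ 1))) ≡ d₁ *ℕ b₁ *ℕ (d₁ *ℕ b₁ *ℕ b₁)
  expanded = ℕ-Ring.solve-∀

-- In a decomposition d₁ b₁ = gcd(|x|, z), because |x| = c |x₁| and
-- z = c · c b₁ with |x₁| coprime to c b₁, where c = d₁ b₁.
gcd-of-decomposition : ∀ {x z d₁ b₁ x₁} →
  x ≡ + d₁ * + b₁ * x₁ → z ≡ d₁ ^ℕ 2 *ℕ b₁ ^ℕ 3 → gcd ∣ x₁ ∣ (d₁ *ℕ b₁) ≡ 1 →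
  gcd ∣ x ∣ z ≡ d₁ *ℕ b₁
gcd-of-decomposition {x} {z} {d₁} {b₁} {x₁} x≡ z≡ gcd≡1 = begin
  gcd ∣ x ∣ z                          ≡⟨ cong₂ gcd ∣x∣≡ (trans z≡ (d₁²b₁³≡c·cb₁ d₁ b₁)) ⟩
  gcd (c *ℕ ∣ x₁ ∣) (c *ℕ (c *ℕ b₁))  ≡⟨ gcd-scaled-coprime c (coprime-*ʳ x₁⊥c x₁⊥b₁) ⟩
  c                                    ∎
  where
  c = d₁ *ℕ b₁
  ∣x∣≡ : ∣ x ∣ ≡ c *ℕ ∣ x₁ ∣
  ∣x∣≡ = trans (cong ∣_∣ x≡)
           (trans (ℤ.abs-* (+ d₁ * + b₁) x₁) (cong (_*ℕ ∣ x₁ ∣) (ℤ.abs-* (+ d₁) (+ b₁))))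
  x₁⊥c : Coprime ∣ x₁ ∣ c
  x₁⊥c = gcd≡1⇒coprime gcd≡1
  x₁⊥b₁ : Coprime ∣ x₁ ∣ b₁
  x₁⊥b₁ = Coprimality.sym (coprime-divisorˡ (Coprimality.sym x₁⊥c) (n∣m*n d₁))

-- Two decompositions of the same point coincide: both have d₁ b₁ = gcd(|x|, z),
-- and cancelling this common value recovers b₁, then d₁, d₀ and x₁.
decomposition-unique : ∀ {A B d x y z} w w′ →
  Decomposition A B d x y z w → Decomposition A B d x y z w′ → w ≡ w′
decomposition-unique {z = z} (d₀ , d₁ , b₁ , x₁) (e₀ , e₁ , c₁ , y₁)
  (_ , d₁≥1 , b₁≥1 , x≡ , z≡ , d≡ , _ , gcd≡1 , _) (_ , _ , _ , x≡′ , z≡′ , d≡′ , _ , gcd≡1′ , _) =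
  cong₂ _,_ d₀≡e₀ (cong₂ _,_ d₁≡e₁ (cong₂ _,_ b₁≡c₁ x₁≡y₁))
  where
  instance
    d₁≢0 : NonZero d₁
    d₁≢0 = >-nonZero d₁≥1
    b₁≢0 : NonZero b₁
    b₁≢0 = >-nonZero b₁≥1
    c≢0 : NonZero (d₁ *ℕ b₁)
    c≢0 = m*n≢0 d₁ b₁
  c = d₁ *ℕ b₁
  c≡ : c ≡ e₁ *ℕ c₁
  c≡ = trans (sym (gcd-of-decomposition {d₁ = d₁} {b₁} {x₁} x≡ z≡ gcd≡1))
             (gcd-of-decomposition {d₁ = e₁} {c₁} {y₁} x≡′ z≡′ gcd≡1′)
  b₁≡c₁ : b₁ ≡ c₁
  b₁≡c₁ = *-cancelˡ-≡ b₁ c₁ c (*-cancelˡ-≡ _ _ c (begin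
    c *ℕ (c *ℕ b₁)                  ≡⟨ sym (trans z≡ (d₁²b₁³≡c·cb₁ d₁ b₁)) ⟩
    z                               ≡⟨ trans z≡′ (d₁²b₁³≡c·cb₁ e₁ c₁) ⟩
    e₁ *ℕ c₁ *ℕ (e₁ *ℕ c₁ *ℕ c₁)   ≡⟨ cong (λ h → h *ℕ (h *ℕ c₁)) (sym c≡) ⟩
    c *ℕ (c *ℕ c₁)                  ∎))
  d₁≡e₁ : d₁ ≡ e₁
  d₁≡e₁ = *-cancelʳ-≡ d₁ e₁ b₁ (trans c≡ (cong (e₁ *ℕ_) (sym b₁≡c₁)))
  d₀≡e₀ : d₀ ≡ e₀
  d₀≡e₀ = *-cancelʳ-≡ d₀ e₀ d₁ (trans (sym d≡) (trans d≡′ (cong (e₀ *ℕ_) (sym d₁≡e₁))))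
  x₁≡y₁ : x₁ ≡ y₁
  x₁≡y₁ = ℤ.*-cancelˡ-≡ (+ c) x₁ y₁ (begin
    + c * x₁                ≡⟨ cong (_* x₁) (ℤ.pos-* d₁ b₁) ⟩
    + d₁ * + b₁ * x₁        ≡⟨ trans (sym x≡) x≡′ ⟩
    + e₁ * + c₁ * y₁        ≡⟨ cong (_* y₁) (sym (ℤ.pos-* e₁ c₁)) ⟩
    + (e₁ *ℕ c₁) * y₁       ≡⟨ cong (λ h → + h * y₁) (sym c≡) ⟩
    + c * y₁                ∎)

record GcdReduction (A B : ℤ) (d : ℕ) (x : ℤ) (y z : ℕ) : Set where
  field
    x′      : ℤ
    z′      : ℕ
    x≡      : x ≡ x′ * + (gcd ∣ x ∣ z)
    z≡      : z ≡ z′ *ℕ gcd ∣ x ∣ z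
    x′⊥z′   : Coprime ∣ x′ ∣ z′
    reduced : + d * (+ y) ^ 2 * + z′ ≡ + (gcd ∣ x ∣ z) * + (gcd ∣ x ∣ z) * cubic A B x′ (+ z′)

gcd-reduction : ∀ A B d x y z .{{_ : NonZero (gcd ∣ x ∣ z)}} →
                + d * (+ y) ^ 2 * + z ≡ cubic A B x (+ z) → GcdReduction A B d x y z
gcd-reduction A B d x y z eqn = record
  { x′ = x′ ; z′ = z′ ; x≡ = x≡ ; z≡ = z≡
  ; x′⊥z′ = coprime-cofactors (trans (cong ∣_∣ x≡) (ℤ.abs-* x′ (+ g))) z≡
  ; reduced = ℤ.*-cancelˡ-≡ (+ g) _ _ (begin
      + g * (+ d * (+ y) ^ 2 * + z′)      ≡⟨ rotate (+ g) (+ d * (+ y) ^ 2) (+ z′) ⟩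
      + d * (+ y) ^ 2 * (+ z′ * + g)      ≡⟨ cong (+ d * (+ y) ^ 2 *_) (sym z≡ℤ) ⟩
      + d * (+ y) ^ 2 * + z               ≡⟨ eqn ⟩
      cubic A B x (+ z)                   ≡⟨ cong₂ (cubic A B) x≡ z≡ℤ ⟩
      cubic A B (x′ * + g) (+ z′ * + g)   ≡⟨ cubic-homogeneous A B x′ (+ z′) (+ g) ⟩
      + g * (+ g * + g * cubic A B x′ (+ z′)) ∎)
  }
  where
  g = gcd ∣ x ∣ z
  g∣x : + g ℤ∣.∣ x
  g∣x = ℤ∣.∣ᵤ⇒∣ (gcd[m,n]∣m ∣ x ∣ z)
  x′ = ℤ∣.quotient g∣x
  x≡ : x ≡ x′ * + g
  x≡ = ℤ∣._∣_.equality g∣x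
  z′ = quotient (gcd[m,n]∣n ∣ x ∣ z)
  z≡ : z ≡ z′ *ℕ g
  z≡ = m∣n⇒n≡quotient*m (gcd[m,n]∣n ∣ x ∣ z)
  z≡ℤ : + z ≡ + z′ * + g
  z≡ℤ = trans (cong +_ z≡) (ℤ.pos-* z′ g)
  rotate : ∀ a b c → a * (b * c) ≡ b * (c * a)
  rotate = solve-∀

abs-equation : ∀ {d y z g F} →
  + d * (+ y) ^ 2 * + z ≡ + g * + g * F → d *ℕ (y *ℕ y) *ℕ z ≡ g *ℕ g *ℕ ∣ F ∣
abs-equation {d} {y} {z} {g} {F} eq = begin
  d *ℕ (y *ℕ y) *ℕ z              ≡⟨ cong (λ n → d *ℕ n *ℕ z) (sym ∣y²∣) ⟩
  d *ℕ ∣ (+ y) ^ 2 ∣ *ℕ z        ≡⟨ sym (trans (ℤ.abs-* (+ d * (+ y) ^ 2) (+ z))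
                                                (cong (_*ℕ z) (ℤ.abs-* (+ d) ((+ y) ^ 2)))) ⟩
  ∣ + d * (+ y) ^ 2 * + z ∣       ≡⟨ cong ∣_∣ eq ⟩
  ∣ + g * + g * F ∣               ≡⟨ ℤ.abs-* (+ g * + g) F ⟩
  ∣ + g * + g ∣ *ℕ ∣ F ∣          ≡⟨ cong (_*ℕ ∣ F ∣) (ℤ.abs-* (+ g) (+ g)) ⟩
  g *ℕ g *ℕ ∣ F ∣                 ∎
  where
  ∣y²∣ : ∣ (+ y) ^ 2 ∣ ≡ y *ℕ y
  ∣y²∣ = trans (abs-^ (+ y) 2) (cong (y *ℕ_) (*-identityʳ y))

cancel-b²t² : ∀ s t b (Y F : ℤ) .{{_ : NonZero (b *ℕ t)}} →
  + (s *ℕ t) * Y * + (b *ℕ b *ℕ t) ≡ + (b *ℕ t) * + (b *ℕ t) * F → + s * Y ≡ F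
cancel-b²t² s t b Y F eq = ℤ.*-cancelˡ-≡ (+ (b *ℕ t *ℕ (b *ℕ t))) (+ s * Y) F {{m*n≢0 _ _}} (begin
  + (b *ℕ t *ℕ (b *ℕ t)) * (+ s * Y)       ≡⟨ cong (_* (+ s * Y)) bt² ⟩
  + b * + t * (+ b * + t) * (+ s * Y)      ≡⟨ regroup (+ s) (+ t) (+ b) Y ⟩
  + s * + t * Y * (+ b * + b * + t)        ≡⟨ sym (cong₂ (λ m n → m * Y * n) (ℤ.pos-* s t) b²t) ⟩
  + (s *ℕ t) * Y * + (b *ℕ b *ℕ t)         ≡⟨ eq ⟩
  + (b *ℕ t) * + (b *ℕ t) * F              ≡⟨ cong (_* F) (sym (ℤ.pos-* (b *ℕ t) (b *ℕ t))) ⟩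
  + (b *ℕ t *ℕ (b *ℕ t)) * F               ∎)
  where
  bt² : + (b *ℕ t *ℕ (b *ℕ t)) ≡ + b * + t * (+ b * + t)
  bt² = trans (ℤ.pos-* (b *ℕ t) (b *ℕ t)) (cong₂ _*_ (ℤ.pos-* b t) (ℤ.pos-* b t))
  b²t : + (b *ℕ b *ℕ t) ≡ + b * + b * + t
  b²t = trans (ℤ.pos-* (b *ℕ b) t) (cong (_* + t) (ℤ.pos-* b b))
  regroup : ∀ s t b Y → b * t * (b * t) * (s * Y) ≡ s * t * Y * (b * b * t)
  regroup = solve-∀

decomposition-exists : ∀ A B d x y z → d ≥ 1 → Squarefree d → z ≥ 1 →
  gcd (gcd ∣ x ∣ y) z ≡ 1 → + d * (+ y) ^ 2 * + z ≡ cubic A B x (+ z) →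
  Σ (ℕ × ℕ × ℕ × ℤ) (Decomposition A B d x y z)
decomposition-exists A B d x y z d≥1 d-sqf z≥1 gcd≡1 eqn =
  assemble (square-part d-sqf (coprime-gcd {∣ x ∣} gcd≡1) (cubic-coprime A B x′ z′ x′⊥z′)
                        (abs-equation {d} {y} {z′} {g} reduced))
  where
  g = gcd ∣ x ∣ z
  instance
    g≢0 : NonZero g
    g≢0 = ≢-nonZero (gcd[m,n]≢0 ∣ x ∣ z (inj₂ (n>0⇒n≢0 z≥1)))
  open GcdReduction (gcd-reduction A B d x y z eqn)
  assemble : (∃₂ λ b t → g ≡ b *ℕ t × z′ ≡ b *ℕ b *ℕ t × t ∣ d) →
             Σ (ℕ × ℕ × ℕ × ℤ) (Decomposition A B d x y z)
  assemble (b , t , g≡bt , z′≡bbt , divides s d≡st) =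
    (s , t , b , x′) ,
    >-nonZero⁻¹ s {{m*n≢0⇒m≢0 s {{st≢0}}}} ,
    >-nonZero⁻¹ t {{m*n≢0⇒n≢0 b {{bt≢0}}}} ,
    >-nonZero⁻¹ b {{m*n≢0⇒m≢0 b {{bt≢0}}}} ,
    trans x≡ (trans (cong (x′ *_) (trans (cong +_ g≡bt) (ℤ.pos-* b t))) (reverse x′ (+ b) (+ t))) ,
    trans z≡ (trans (cong₂ _*ℕ_ z′≡bbt g≡bt) (b²t*bt≡t²b³ b t)) ,
    d≡st ,
    subst Squarefree d≡st d-sqf ,
    coprime⇒gcd≡1 (Coprimality.sym (coprime-divisorˡ (Coprimality.sym x′⊥z′) tb∣z′)) ,
    trans (cancel-b²t² s t b ((+ y) ^ 2) (cubic A B x′ (+ (b *ℕ b *ℕ t))) {{bt≢0}} equation)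
          (cubic-at-b²t A B x′ b t)
    where
    reverse : ∀ a b c → a * (b * c) ≡ c * b * a
    reverse = solve-∀
    b²t≡b*tb : ∀ b t → b *ℕ b *ℕ t ≡ b *ℕ (t *ℕ b)
    b²t≡b*tb = ℕ-Ring.solve-∀
    b²t*bt≡t²b³ : ∀ b t → b *ℕ b *ℕ t *ℕ (b *ℕ t) ≡ t ^ℕ 2 *ℕ b ^ℕ 3
    b²t*bt≡t²b³ = expanded
      where
      expanded : ∀ b t → b *ℕ b *ℕ t *ℕ (b *ℕ t) ≡ t *ℕ (t *ℕ 1) *ℕ (b *ℕ (b *ℕ (b *ℕ 1)))
      expanded = ℕ-Ring.solve-∀
    bt≢0 : NonZero (b *ℕ t)
    bt≢0 = subst NonZero g≡bt g≢0
    st≢0 : NonZero (s *ℕ t)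
    st≢0 = subst NonZero d≡st (>-nonZero d≥1)
    tb∣z′ : t *ℕ b ∣ z′
    tb∣z′ = divides b (trans z′≡bbt (b²t≡b*tb b t))
    equation : + (s *ℕ t) * (+ y) ^ 2 * + (b *ℕ b *ℕ t)
             ≡ + (b *ℕ t) * + (b *ℕ t) * cubic A B x′ (+ (b *ℕ b *ℕ t))
    equation = begin
      + (s *ℕ t) * (+ y) ^ 2 * + (b *ℕ b *ℕ t)
        ≡⟨ cong₂ (λ m n → + m * (+ y) ^ 2 * + n) (sym d≡st) (sym z′≡bbt) ⟩
      + d * (+ y) ^ 2 * + z′
        ≡⟨ reduced ⟩
      + g * + g * cubic A B x′ (+ z′)
        ≡⟨ cong₂ (λ m n → + m * + m * cubic A B x′ (+ n)) g≡bt z′≡bbt ⟩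
      + (b *ℕ t) * + (b *ℕ t) * cubic A B x′ (+ (b *ℕ b *ℕ t)) ∎

lemma1 : (A B : ℤ) → (+ 4) * A ^ 3 + (+ 27) * B ^ 2 ≢ + 0 →
           (d : ℕ) → d ≥ 1 → Squarefree d →
           (x : ℤ) (y z : ℕ) → y ≥ 1 → z ≥ 1 →
           gcd (gcd ∣ x ∣ y) z ≡ 1 →
           (+ d) * (+ y) ^ 2 * (+ z) ≡ x ^ 3 + A * x * (+ z) ^ 2 + B * (+ z) ^ 3 →
           ∃! {A = ℕ × ℕ × ℕ × ℤ} _≡_ (λ { (d₀ , d₁ , b₁ , x₁) →
               d₀ ≥ 1 × d₁ ≥ 1 × b₁ ≥ 1 ×
               x ≡ (+ d₁) * (+ b₁) * x₁ ×
               z ≡ (d₁ ^ℕ 2) *ℕ (b₁ ^ℕ 3) ×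
               d ≡ d₀ *ℕ d₁ ×
               AbsMobiusIsOne (d₀ *ℕ d₁) ×
               gcd ∣ x₁ ∣ (d₁ *ℕ b₁) ≡ 1 ×
               (+ d₀) * (+ y) ^ 2 ≡ x₁ ^ 3 + A * x₁ * (+ d₁) ^ 2 * (+ b₁) ^ 4 + B * (+ d₁) ^ 3 * (+ b₁) ^ 6 })
lemma1 A B _ d d≥1 d-sqf x y z _ z≥1 gcd≡1 eqn =
  w , valid , λ {w′} → decomposition-unique {A} {B} {d} {x} {y} {z} w w′ valid
  where
  existence : Σ (ℕ × ℕ × ℕ × ℤ) (Decomposition A B d x y z)
  existence = decomposition-exists A B d x y z d≥1 d-sqf z≥1 gcd≡1 eqn
  w : ℕ × ℕ × ℕ × ℤ
  w = proj₁ existence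
  valid : Decomposition A B d x y z w
  valid = proj₂ existence
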